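{- Let $A$ be a finite set and let $R\subseteq A^2$ be subdirect, linked and proper. Then $R$ pp-defines a relation $S\subseteq A^2$ which is subdirect, proper, central, and which is symmetric or transitive.
   Context: A relation $R\subseteq A\times A$ is subdirect if both of its projections equal $A$; proper if $R\neq A^2$. For binary relations $R,S$ write $R+S=\{(a,c):\exists b\,(a,b)\in R,(b,c)\in S\}$ and $-R=R^{ -1}$, $R-S=R+(-S)$. $R$ is linked if $(R-R)+(R-R)+\dots+(R-R)$ equals $(\mathrm{proj}_1R)^2$ for some number of summands. The left center of $R\subseteq A\times B$ is $\{a\in A: (a,b)\in R\text{ for all } b\in B\}$; the right center is defined symmetrically; $R$ is central if both its left and right centers are nonempty. A set of relations pp-defines $S$ if $S$ is definable by a primitive positive formula using those relations, equality, and singleton unary relations (parameters). -}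

module Defs where

open import Data.Nat using (ℕ; suc)
open import Data.Fin using (Fin; zero; suc)
open import Data.Product using (Σ; ∃; _×_; _,_)
open import Data.List using (List)
open import Data.List.Relation.Unary.All using (All)
open import Relation.Nullary using (¬_)
open import Relation.Binary.PropositionalEquality using (_≡_)

BRel : ℕ → Set₁
BRel n = Fin n → Fin n → Set

module _ {n : ℕ} where

  Subdirect : BRel n → Set
  Subdirect R = (∀ a → ∃ λ b → R a b) × (∀ b → ∃ λ a → R a b)

  Proper : BRel n → Set
  Proper R = Σ (Fin n) λ a → Σ (Fin n) λ b → ¬ R a b

  _⊕_ : BRel n → BRel n → BRel n
  (R ⊕ S) a c = ∃ λ b → R a b × S b c

  conv : BRel n → BRel n
  conv R a b = R b a

  _⊖_ : BRel n → BRel n → BRel n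
  R ⊖ S = R ⊕ conv S

  -- (R - R) + ... + (R - R) with (suc m) summands
  linkIter : BRel n → ℕ → BRel n
  linkIter R ℕ.zero = R ⊖ R
  linkIter R (suc m) = linkIter R m ⊕ (R ⊖ R)

  proj₁R : BRel n → Fin n → Set
  proj₁R R a = ∃ λ b → R a b

  Linked : BRel n → Set
  Linked R = ∃ λ m → ∀ a c →
    (linkIter R m a c → proj₁R R a × proj₁R R c) ×
    (proj₁R R a × proj₁R R c → linkIter R m a c)

  Central : BRel n → Set
  Central S = (∃ λ a → ∀ b → S a b) × (∃ λ b → ∀ a → S a b)

  Symmetric : BRel n → Set
  Symmetric S = ∀ a b → S a b → S b a

  Transitive : BRel n → Set
  Transitive S = ∀ a b c → S a b → S b c → S a c

-- Primitive positive formulas (in prenex normal form ∃ ȳ. ⋀ atoms) over the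
-- language {R, =, singleton constants}, with variables Fin m.
data Atom (n m : ℕ) : Set where
  rel   : Fin m → Fin m → Atom n m
  eq    : Fin m → Fin m → Atom n m
  const : Fin m → Fin n → Atom n m

-- A pp-formula with two free variables x (= var 0), y (= var 1)
-- and k existentially quantified variables (var 2 .. var (k+1)).
record PP (n : ℕ) : Set where
  constructor pp
  field
    k     : ℕ
    atoms : List (Atom n (suc (suc k)))

module _ {n : ℕ} (R : BRel n) where

  ⟦_⟧A : ∀ {m} → Atom n m → (Fin m → Fin n) → Set
  ⟦ rel u v ⟧A ρ = R (ρ u) (ρ v)
  ⟦ eq u v ⟧A ρ = ρ u ≡ ρ v
  ⟦ const u c ⟧A ρ = ρ u ≡ c

  env : ∀ {k} → Fin n → Fin n → (Fin k → Fin n) → Fin (suc (suc k)) → Fin n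
  env a b e zero = a
  env a b e (suc zero) = b
  env a b e (suc (suc i)) = e i

  ⟦_⟧ : PP n → BRel n
  ⟦ pp k atoms ⟧ a b = Σ (Fin k → Fin n) λ e → All (λ t → ⟦ t ⟧A (env a b e)) atoms

PPDefines : ∀ {n} → BRel n → BRel n → Set
PPDefines R S = ∃ λ φ → ∀ a b → (S a b → ⟦ R ⟧ φ a b) × (⟦ R ⟧ φ a b → S a b)

{-# OPTIONS --safe #-}

-- Let E = R ⊖ R, which is reflexive and symmetric. A proper symmetric pp-definable T with T ⊖ T
-- full already yields the theorem: adding points to X, the relations T ⊕ (above X ∩ T⁻¹) either
-- stay full, so T has a right centre and is central, or the first proper one is symmetric and
-- central. If E is not full, linkedness makes the last proper power of E such a T. If E is full,
-- the argument applied to R and R⁻¹ gives R a right and a left centre, unless R⁻¹ ⊖ R⁻¹ is such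
-- a T. For central R, a power of R that is idempotent under composition is transitive, unless it
-- is full; then the last proper power T has T ⊕ T full, and shrinking T ⊕ (above X, below Y ∩ T)
-- in X and Y produces a proper relation with a point in both centres, whose symmetric part works.

module Submission where

open import Defs
open import Data.Nat using (ℕ; zero; suc; _+_; _*_; _∸_; _^_; _≤_)
open import Data.Nat.Properties
  using (+-comm; +-suc; +-assoc; ≤-trans; m≤n+m; m≤m*n; m∸n+n≡m; n<1+n; m≤n⇒∃[o]m+o≡n)
open import Data.Fin using (Fin; zero; suc; _↑ˡ_; _↑ʳ_; splitAt; toℕ; funToFin; finToFun)
open import Data.Fin.Properties using (any?; all?; ¬∀⟶∃¬; pigeonhole; finToFun-funToFin)
open import Data.Vec.Functional as V using (Vector; _++_)
open import Data.Vec.Functional.Properties using (lookup-++ˡ; lookup-++ʳ; ++-cong)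
open import Data.Product using (Σ; ∃; ∃₂; _×_; _,_; proj₁; proj₂)
open import Data.Sum using (_⊎_; inj₁; inj₂; [_,_]′)
open import Data.Sum.Properties using ([,]-∘)
open import Data.Unit using (⊤; tt)
open import Data.List using (List; []; _∷_; _∷ʳ_; map; allFin)
import Data.List as List
open import Data.List.Relation.Unary.All as All using (All; []; _∷_)
import Data.List.Relation.Unary.All.Properties as All
open import Data.List.Relation.Unary.Any using (here; there)
open import Data.List.Membership.Propositional using (_∈_)
open import Data.List.Membership.Propositional.Properties using (∈-++⁺ʳ; ∈-++⁺ˡ; ∈-allFin)
open import Data.List.Relation.Binary.Pointwise as Pointwise using ([]; _∷_; Pointwise-≡⇒≡)
open import Data.List.Relation.Binary.Suffix.Heterogeneous using (Suffix; here; there)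
open import Relation.Nullary using (¬_; Dec; yes; no; contradiction)
open import Relation.Nullary.Decidable using (_×-dec_)
open import Relation.Binary using (Decidable; _⇔_)
open import Relation.Binary.Construct.Intersection using (_∩_)
open import Relation.Binary.PropositionalEquality using (_≡_; refl; sym; trans; cong; subst; subst₂; _≗_)
open import Function using (_∘_; id)

module _ {n : ℕ} where

  Full : BRel n → Set
  Full S = ∀ a b → S a b

  LeftCentre : BRel n → Fin n → Set
  LeftCentre S a = ∀ b → S a b

  RightCentre : BRel n → Fin n → Set
  RightCentre S b = ∀ a → S a b

  Full? : ∀ {S : BRel n} → Decidable S → Dec (Full S)
  Full? S? = all? λ a → all? (S? a)

  ¬Full⇒Proper : ∀ {S : BRel n} → Decidable S → ¬ Full S → Proper S
  ¬Full⇒Proper S? ¬full =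
    let a , ¬row = ¬∀⟶∃¬ n _ (λ a → all? (S? a)) ¬full
        b , ¬Sab = ¬∀⟶∃¬ n _ (S? a) ¬row
    in a , b , ¬Sab

  Central⇒Subdirect : ∀ {S : BRel n} → Central S → Subdirect S
  Central⇒Subdirect ((l , l-centre) , (r , r-centre)) =
    (λ a → r , r-centre a) , (λ b → l , l-centre b)

  conv-dec : ∀ {S : BRel n} → Decidable S → Decidable (conv S)
  conv-dec S? a b = S? b a

  ⊕-dec : ∀ {S T : BRel n} → Decidable S → Decidable T → Decidable (S ⊕ T)
  ⊕-dec S? T? a c = any? λ b → S? a b ×-dec T? b c

  ⊖-dec : ∀ {S T : BRel n} → Decidable S → Decidable T → Decidable (S ⊖ T)
  ⊖-dec S? T? = ⊕-dec S? (conv-dec T?)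

  ⊖-self-sym : ∀ {S : BRel n} → Symmetric (S ⊖ S)
  ⊖-self-sym a b (c , s , s′) = c , s′ , s

  ⊖-self-refl : ∀ {S : BRel n} → (∀ a → ∃ (S a)) → ∀ a → (S ⊖ S) a a
  ⊖-self-refl has-succ a = let b , s = has-succ a in b , s , s

  ⇔-sym : ∀ {S T : BRel n} → S ⇔ T → T ⇔ S
  ⇔-sym (S⇒T , T⇒S) = T⇒S , S⇒T

  ⇔-trans : ∀ {S T U : BRel n} → S ⇔ T → T ⇔ U → S ⇔ U
  ⇔-trans (S⇒T , T⇒S) (T⇒U , U⇒T) = T⇒U ∘ S⇒T , T⇒S ∘ U⇒T

  ⊕-assoc : ∀ {S T U : BRel n} → (S ⊕ (T ⊕ U)) ⇔ ((S ⊕ T) ⊕ U)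
  ⊕-assoc = (λ (b , s , c , t , u) → c , (b , s , t) , u) ,
            (λ (c , (b , s , t) , u) → b , s , c , t , u)

  ⊕-congˡ : ∀ {S T U : BRel n} → S ⇔ T → (S ⊕ U) ⇔ (T ⊕ U)
  ⊕-congˡ (S⇒T , T⇒S) = (λ (b , s , u) → b , S⇒T s , u) , (λ (b , t , u) → b , T⇒S t , u)

  -- S ^⁺ j is the composite of j + 1 copies of S, the indexing of linkIter.
  infixl 30 _^⁺_
  _^⁺_ : BRel n → ℕ → BRel n
  S ^⁺ zero = S
  S ^⁺ suc j = S ^⁺ j ⊕ S

  linkIter≡^⁺ : ∀ (R : BRel n) j → linkIter R j ≡ (R ⊖ R) ^⁺ j
  linkIter≡^⁺ R zero = refl
  linkIter≡^⁺ R (suc j) = cong (_⊕ (R ⊖ R)) (linkIter≡^⁺ R j)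

  ^⁺-dec : ∀ {S : BRel n} → Decidable S → ∀ j → Decidable (S ^⁺ j)
  ^⁺-dec S? zero = S?
  ^⁺-dec S? (suc j) = ⊕-dec (^⁺-dec S? j) S?

  ^⁺-+ : ∀ (S : BRel n) i j → (S ^⁺ i ⊕ S ^⁺ j) ⇔ S ^⁺ suc (j + i)
  ^⁺-+ S i zero = id , id
  ^⁺-+ S i (suc j) = ⇔-trans ⊕-assoc (⊕-congˡ (^⁺-+ S i j))

  ^⁺-cong-+ˡ : ∀ (S : BRel n) t {a b} → S ^⁺ a ⇔ S ^⁺ b → S ^⁺ (t + a) ⇔ S ^⁺ (t + b)
  ^⁺-cong-+ˡ S zero a⇔b = a⇔b
  ^⁺-cong-+ˡ S (suc t) a⇔b = ⊕-congˡ (^⁺-cong-+ˡ S t a⇔b)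

  ⊕-^⁺-comm : ∀ (S : BRel n) j → (S ⊕ S ^⁺ j) ⇔ (S ^⁺ j ⊕ S)
  ⊕-^⁺-comm S zero = id , id
  ⊕-^⁺-comm S (suc j) = ⇔-trans ⊕-assoc (⊕-congˡ (⊕-^⁺-comm S j))

  Symmetric-^⁺ : ∀ {S : BRel n} → Symmetric S → ∀ j → Symmetric (S ^⁺ j)
  Symmetric-^⁺ S-sym zero = S-sym
  Symmetric-^⁺ {S} S-sym (suc j) a b (c , s , s′) =
    proj₁ (⊕-^⁺-comm S j) (c , S-sym c b s′ , Symmetric-^⁺ S-sym j a c s)

  ⊆-^⁺ : ∀ {S : BRel n} → (∀ a → S a a) → ∀ j {a b} → S a b → (S ^⁺ j) a b
  ⊆-^⁺ S-refl zero s = s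
  ⊆-^⁺ S-refl (suc j) {b = b} s = b , ⊆-^⁺ S-refl j s , S-refl b

  LeftCentre-^⁺ : ∀ {S : BRel n} {l} → LeftCentre S l → ∀ j → LeftCentre (S ^⁺ j) l
  LeftCentre-^⁺ l-centre zero = l-centre
  LeftCentre-^⁺ {l = l} l-centre (suc j) b = l , LeftCentre-^⁺ l-centre j l , l-centre b

  RightCentre-^⁺ : ∀ {S : BRel n} {r} → RightCentre S r → ∀ j → RightCentre (S ^⁺ j) r
  RightCentre-^⁺ r-centre zero = r-centre
  RightCentre-^⁺ {r = r} r-centre (suc j) a = r , RightCentre-^⁺ r-centre j a , r-centre r

  Full-^⁺-+ : ∀ {S : BRel n} {l} → LeftCentre S l →
              ∀ {k} → Full (S ^⁺ k) → ∀ t → Full (S ^⁺ (t + k))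
  Full-^⁺-+ l-centre full zero = full
  Full-^⁺-+ {l = l} l-centre full (suc t) a b = l , Full-^⁺-+ l-centre full t a l , l-centre b

lastFailure : {P : ℕ → Set} → (∀ k → Dec (P k)) →
              ¬ P 0 → ∀ k → P k → ∃ λ j → ¬ P j × P (suc j)
lastFailure P? ¬P₀ zero P₀ = contradiction P₀ ¬P₀
lastFailure P? ¬P₀ (suc k) Pk+1 with P? k
... | yes Pk = lastFailure P? ¬P₀ k Pk
... | no ¬Pk = k , ¬Pk , Pk+1

firstFailingCons : {A : Set} {P : List A → Set} → (∀ xs → Dec (P xs)) → P [] →
                   ∀ xs → ¬ P xs → ∃₂ λ x ys → P ys × ¬ P (x ∷ ys)
firstFailingCons P? P[] [] ¬P[] = contradiction P[] ¬P[]
firstFailingCons P? P[] (x ∷ xs) ¬Px∷xs with P? xs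
... | yes Pxs = x , xs , Pxs , ¬Px∷xs
... | no ¬Pxs = firstFailingCons P? P[] xs ¬Pxs

OnTail : {A : Set} → (List A → Set) → List A → Set
OnTail P [] = ⊤
OnTail P (_ ∷ xs) = P xs

module _ {A B : Set} {F : List A → List B → Set} (F? : ∀ xs ys → Dec (F xs ys)) where

  record MinimalFailure (xs : List A) (ys : List B) : Set where
    constructor minimal
    field
      {xs′} : List A
      {ys′} : List B
      xs′-suffix : Suffix _≡_ xs′ xs
      ys′-suffix : Suffix _≡_ ys′ ys
      fails : ¬ F xs′ ys′
      holdsˡ : OnTail (λ zs → F zs ys′) xs′
      holdsʳ : OnTail (F xs′) ys′

  private
    suffix-refl : ∀ {C : Set} {zs : List C} → Suffix _≡_ zs zs
    suffix-refl = here (Pointwise.refl refl)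

    dropˡ : ∀ {x xs ys} → MinimalFailure xs ys → MinimalFailure (x ∷ xs) ys
    dropˡ (minimal sx sy f hl hr) = minimal (there sx) sy f hl hr

    dropʳ : ∀ {xs y ys} → MinimalFailure xs ys → MinimalFailure xs (y ∷ ys)
    dropʳ (minimal sx sy f hl hr) = minimal sx (there sy) f hl hr

  minimalFailure : ∀ xs ys → ¬ F xs ys → MinimalFailure xs ys
  minimalFailure [] ys = alongʸ ys
    where
    alongʸ : ∀ ys → ¬ F [] ys → MinimalFailure [] ys
    alongʸ [] ¬F = minimal suffix-refl suffix-refl ¬F tt tt
    alongʸ (y ∷ ys) ¬F with F? [] ys
    ... | yes F′ = minimal suffix-refl suffix-refl ¬F tt F′
    ... | no ¬F′ = dropʳ (alongʸ ys ¬F′)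
  minimalFailure (x ∷ xs) ys = alongʸ ys
    where
    alongʸ : ∀ ys → ¬ F (x ∷ xs) ys → MinimalFailure (x ∷ xs) ys
    alongʸ ys ¬F with F? xs ys
    ... | no ¬F′ = dropˡ (minimalFailure xs ys ¬F′)
    alongʸ [] ¬F | yes F′ = minimal suffix-refl suffix-refl ¬F F′ tt
    alongʸ (y ∷ ys) ¬F | yes F′ with F? (x ∷ xs) ys
    ... | yes F″ = minimal suffix-refl suffix-refl ¬F F′ F″
    ... | no ¬F″ = dropʳ (alongʸ ys ¬F″)

∈-suffix-∷ʳ : {A : Set} {e x : A} {xs : List A} →
              ∀ zs → Suffix _≡_ (x ∷ xs) (zs ∷ʳ e) → e ∈ x ∷ xs
∈-suffix-∷ʳ [] (here (refl ∷ [])) = here refl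
∈-suffix-∷ʳ [] (there (here ()))
∈-suffix-∷ʳ (z ∷ zs) (here zs≋) rewrite Pointwise-≡⇒≡ zs≋ = ∈-++⁺ʳ (z ∷ zs) (here refl)
∈-suffix-∷ʳ (z ∷ zs) (there s) = ∈-suffix-∷ʳ zs s

module _ {n : ℕ} where

  private
    indicator : {P : Set} → Dec P → Fin 2
    indicator (yes _) = suc zero
    indicator (no _) = zero

    indicator-injective : {P Q : Set} (p : Dec P) (q : Dec Q) →
                          indicator p ≡ indicator q → (P → Q) × (Q → P)
    indicator-injective (yes p) (yes q) _ = (λ _ → q) , (λ _ → p)
    indicator-injective (no ¬p) (no ¬q) _ = (λ p → contradiction p ¬p) , (λ q → contradiction q ¬q)

    funToFin-injective : ∀ {m k} (f g : Fin m → Fin k) → funToFin f ≡ funToFin g → f ≗ g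
    funToFin-injective f g f≡g i =
      trans (sym (finToFun-funToFin f i)) (trans (cong (λ c → finToFun c i) f≡g) (finToFun-funToFin g i))

    code : {S : BRel n} → Decidable S → Fin ((2 ^ n) ^ n)
    code S? = funToFin λ a → funToFin λ b → indicator (S? a b)

    code-injective : {S T : BRel n} (S? : Decidable S) (T? : Decidable T) → code S? ≡ code T? → S ⇔ T
    code-injective {S} {T} S? T? codes≡ = (λ {a} {b} → proj₁ (same a b)) , (λ {a} {b} → proj₂ (same a b))
      where
      same : ∀ a b → (S a b → T a b) × (T a b → S a b)
      same a b = indicator-injective (S? a b) (T? a b)
        (funToFin-injective _ _ (funToFin-injective _ _ codes≡ a) b)

  eventuallyPeriodic : (S : ℕ → BRel n) → (∀ k → Decidable (S k)) →
                       ∃₂ λ i q → S i ⇔ S (suc q + i)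
  eventuallyPeriodic S S? with i , j , i<j , codes≡ ← pigeonhole (n<1+n _) (λ k → code (S? (toℕ k))) =
    let q , i+1+q≡j = m≤n⇒∃[o]m+o≡n i<j
        j≡q+1+i = trans (sym i+1+q≡j) (cong suc (+-comm (toℕ i) q))
    in toℕ i , q ,
       subst (λ k → S (toℕ i) ⇔ S k) j≡q+1+i (code-injective (S? (toℕ i)) (S? (toℕ j)) codes≡)

  ^⁺-periodic : ∀ (S : BRel n) {i p} → S ^⁺ i ⇔ S ^⁺ (p + i) →
                ∀ {a} → i ≤ a → S ^⁺ a ⇔ S ^⁺ (p + a)
  ^⁺-periodic S {i} {p} base {a} i≤a =
    subst₂ (λ x y → S ^⁺ x ⇔ S ^⁺ y) t+i≡a t+[p+i]≡p+a (^⁺-cong-+ˡ S (a ∸ i) base)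
    where
    t+i≡a : a ∸ i + i ≡ a
    t+i≡a = m∸n+n≡m i≤a
    t+[p+i]≡p+a : a ∸ i + (p + i) ≡ p + a
    t+[p+i]≡p+a = trans (sym (+-assoc (a ∸ i) p i))
      (trans (cong (_+ i) (+-comm (a ∸ i) p)) (trans (+-assoc p (a ∸ i) i) (cong (p +_) t+i≡a)))

  ^⁺-periodic-* : ∀ (S : BRel n) {i p} → S ^⁺ i ⇔ S ^⁺ (p + i) →
                  ∀ m {a} → i ≤ a → S ^⁺ a ⇔ S ^⁺ (m * p + a)
  ^⁺-periodic-* S base zero i≤a = id , id
  ^⁺-periodic-* S {p = p} base (suc m) {a} i≤a =
    ⇔-trans (^⁺-periodic-* S {p = p} base m i≤a)
      (subst (λ x → S ^⁺ (m * p + a) ⇔ S ^⁺ x) (sym (+-assoc p (m * p) a))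
        (^⁺-periodic S {p = p} base (≤-trans i≤a (m≤n+m a (m * p)))))

  -- e + 1 = (i + 1)(q + 1) is a multiple of the period beyond i, so S ^⁺ (2e + 1) ⇔ S ^⁺ e.
  ^⁺-idempotent : ∀ (S : BRel n) {i q} → S ^⁺ i ⇔ S ^⁺ (suc q + i) →
                  ∃ λ e → (S ^⁺ e ⊕ S ^⁺ e) ⇔ S ^⁺ e
  ^⁺-idempotent S {i} {q} base =
    e , ⇔-trans (^⁺-+ S e e) (⇔-sym (^⁺-periodic-* S {p = suc q} base (suc i) i≤e))
    where
    e : ℕ
    e = q + i * suc q
    i≤e : i ≤ e
    i≤e = ≤-trans (m≤m*n i (suc q)) (m≤n+m _ q)

module PrimitivePositive {n : ℕ} (R : BRel n) where

  -- m free variables followed by k existentially quantified ones; a PP n is a Formula 2.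
  Formula : ℕ → Set
  Formula m = Σ ℕ λ k → List (Atom n (m + k))

  Holds : ∀ {m} → List (Atom n m) → Vector (Fin n) m → Set
  Holds ts ρ = All (λ t → ⟦ R ⟧A t ρ) ts

  Sat : ∀ {m} → Formula m → Vector (Fin n) m → Set
  Sat (k , ts) ρ = Σ (Vector (Fin n) k) λ e → Holds ts (ρ ++ e)

  renameAtom : ∀ {m m′} → (Fin m → Fin m′) → Atom n m → Atom n m′
  renameAtom f (rel u v) = rel (f u) (f v)
  renameAtom f (eq u v) = eq (f u) (f v)
  renameAtom f (const u c) = const (f u) c

  Holds-resp : ∀ {m} (ts : List (Atom n m)) {ρ ρ′} → ρ ≗ ρ′ → Holds ts ρ → Holds ts ρ′
  Holds-resp ts {ρ} {ρ′} ρ≗ρ′ = All.map (λ {t} → atom-resp t)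
    where
    atom-resp : ∀ t → ⟦ R ⟧A t ρ → ⟦ R ⟧A t ρ′
    atom-resp (rel u v) = subst₂ R (ρ≗ρ′ u) (ρ≗ρ′ v)
    atom-resp (eq u v) p = trans (sym (ρ≗ρ′ u)) (trans p (ρ≗ρ′ v))
    atom-resp (const u c) p = trans (sym (ρ≗ρ′ u)) p

  renameAtom-sem : ∀ {m m′} (f : Fin m → Fin m′) t {σ} →
                   ⟦ R ⟧A (renameAtom f t) σ ≡ ⟦ R ⟧A t (σ ∘ f)
  renameAtom-sem f (rel u v) = refl
  renameAtom-sem f (eq u v) = refl
  renameAtom-sem f (const u c) = refl

  rename⁺ : ∀ {m m′} (f : Fin m → Fin m′) (ts : List (Atom n m)) {σ τ} →
            σ ∘ f ≗ τ → Holds ts τ → Holds (map (renameAtom f) ts) σ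
  rename⁺ f ts σ∘f≗τ =
    All.map⁺ ∘ All.map (λ {t} → subst id (sym (renameAtom-sem f t))) ∘ Holds-resp ts (sym ∘ σ∘f≗τ)

  rename⁻ : ∀ {m m′} (f : Fin m → Fin m′) (ts : List (Atom n m)) {σ τ} →
            σ ∘ f ≗ τ → Holds (map (renameAtom f) ts) σ → Holds ts τ
  rename⁻ f ts σ∘f≗τ =
    Holds-resp ts σ∘f≗τ ∘ All.map (λ {t} → subst id (renameAtom-sem f t)) ∘ All.map⁻

  reindex : ∀ {m m′ k k′} → (Fin m → Fin m′) → (Fin k → Fin k′) → Fin (m + k) → Fin (m′ + k′)
  reindex {m} {m′} {k} {k′} f g = [ (λ u → f u ↑ˡ k′) , (λ i → m′ ↑ʳ g i) ]′ ∘ splitAt m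

  ++-reindex : ∀ {m m′ k k′} (f : Fin m → Fin m′) (g : Fin k → Fin k′)
               (ρ : Vector (Fin n) m′) (e : Vector (Fin n) k′) →
               (ρ ++ e) ∘ reindex f g ≗ (ρ ∘ f) ++ (e ∘ g)
  ++-reindex {m} f g ρ e i = trans ([,]-∘ (ρ ++ e) (splitAt m i))
    (++-cong _ (ρ ∘ f) (lookup-++ˡ ρ e ∘ f) (lookup-++ʳ ρ e ∘ g) i)

  _[_] : ∀ {m m′} → Formula m → (Fin m → Fin m′) → Formula m′
  (k , ts) [ f ] = k , map (renameAtom (reindex f id)) ts

  ++-reindex-id : ∀ {m m′ k} (f : Fin m → Fin m′) (ρ : Vector (Fin n) m′) {τ}
                  (e : Vector (Fin n) k) → ρ ∘ f ≗ τ → (ρ ++ e) ∘ reindex f id ≗ τ ++ e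
  ++-reindex-id f ρ e ρ∘f≗τ i =
    trans (++-reindex f id ρ e i) (++-cong _ _ ρ∘f≗τ (λ _ → refl) i)

  Sat-[]⁺ : ∀ {m m′} (φ : Formula m) (f : Fin m → Fin m′) {ρ τ} →
            ρ ∘ f ≗ τ → Sat φ τ → Sat (φ [ f ]) ρ
  Sat-[]⁺ (k , ts) f {ρ} ρ∘f≗τ (e , h) = e , rename⁺ (reindex f id) ts (++-reindex-id f ρ e ρ∘f≗τ) h

  Sat-[]⁻ : ∀ {m m′} (φ : Formula m) (f : Fin m → Fin m′) {ρ τ} →
            ρ ∘ f ≗ τ → Sat (φ [ f ]) ρ → Sat φ τ
  Sat-[]⁻ (k , ts) f {ρ} ρ∘f≗τ (e , h) = e , rename⁻ (reindex f id) ts (++-reindex-id f ρ e ρ∘f≗τ) h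

  weakenˡ : ∀ {m} k₁ k₂ → Fin (m + k₁) → Fin (m + (k₁ + k₂))
  weakenˡ {m} k₁ k₂ = reindex {m} id (_↑ˡ k₂)

  weakenʳ : ∀ {m} k₁ k₂ → Fin (m + k₂) → Fin (m + (k₁ + k₂))
  weakenʳ {m} k₁ k₂ = reindex {m} id (k₁ ↑ʳ_)

  _∧_ : ∀ {m} → Formula m → Formula m → Formula m
  _∧_ {m} (k₁ , ts) (k₂ , us) =
    k₁ + k₂ ,
    map (renameAtom (weakenˡ {m} k₁ k₂)) ts List.++ map (renameAtom (weakenʳ {m} k₁ k₂)) us

  Sat-∧⁺ : ∀ {m} (φ ψ : Formula m) {ρ} → Sat φ ρ → Sat ψ ρ → Sat (φ ∧ ψ) ρ
  Sat-∧⁺ {m} (k₁ , ts) (k₂ , us) {ρ} (e₁ , h₁) (e₂ , h₂) = e₁ ++ e₂ , All.++⁺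
    (rename⁺ (weakenˡ {m} k₁ k₂) ts (λ i → trans (++-reindex id (_↑ˡ k₂) ρ (e₁ ++ e₂) i)
                                             (++-cong ρ ρ (λ _ → refl) (lookup-++ˡ e₁ e₂) i)) h₁)
    (rename⁺ (weakenʳ {m} k₁ k₂) us (λ i → trans (++-reindex id (k₁ ↑ʳ_) ρ (e₁ ++ e₂) i)
                                             (++-cong ρ ρ (λ _ → refl) (lookup-++ʳ e₁ e₂) i)) h₂)

  Sat-∧⁻ : ∀ {m} (φ ψ : Formula m) {ρ} → Sat (φ ∧ ψ) ρ → Sat φ ρ × Sat ψ ρ
  Sat-∧⁻ {m} (k₁ , ts) (k₂ , us) {ρ} (e , h)
    with h₁ , h₂ ← All.++⁻ (map (renameAtom (weakenˡ {m} k₁ k₂)) ts) h =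
    (e ∘ (_↑ˡ k₂) , rename⁻ (weakenˡ {m} k₁ k₂) ts (++-reindex id (_↑ˡ k₂) ρ e) h₁) ,
    (e ∘ (k₁ ↑ʳ_) , rename⁻ (weakenʳ {m} k₁ k₂) us (++-reindex id (k₁ ↑ʳ_) ρ e) h₂)

  bindFirst : ∀ {m k} → Fin (suc m + k) → Fin (m + suc k)
  bindFirst {m} {k} = [ (m ↑ʳ zero) V.∷ (_↑ˡ suc k) , (λ i → m ↑ʳ suc i) ]′ ∘ splitAt (suc m)

  ∃′ : ∀ {m} → Formula (suc m) → Formula m
  ∃′ {m} (k , ts) = suc k , map (renameAtom (bindFirst {m} {k})) ts

  ++-bindFirst : ∀ {m k} (ρ : Vector (Fin n) m) (e : Vector (Fin n) (suc k)) →
                 (ρ ++ e) ∘ bindFirst {m} {k} ≗ (e zero V.∷ ρ) ++ (e ∘ suc)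
  ++-bindFirst {m} ρ e i = trans ([,]-∘ (ρ ++ e) (splitAt (suc m) i))
    (++-cong _ _ quantified (lookup-++ʳ ρ e ∘ suc) i)
    where
    quantified : (ρ ++ e) ∘ ((m ↑ʳ zero) V.∷ (_↑ˡ _)) ≗ e zero V.∷ ρ
    quantified zero = lookup-++ʳ ρ e zero
    quantified (suc u) = lookup-++ˡ ρ e u

  Sat-∃′⁺ : ∀ {m} (φ : Formula (suc m)) {ρ} a → Sat φ (a V.∷ ρ) → Sat (∃′ φ) ρ
  Sat-∃′⁺ (k , ts) {ρ} a (e , h) = a V.∷ e , rename⁺ bindFirst ts (++-bindFirst ρ (a V.∷ e)) h

  Sat-∃′⁻ : ∀ {m} (φ : Formula (suc m)) {ρ} → Sat (∃′ φ) ρ → ∃ λ a → Sat φ (a V.∷ ρ)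
  Sat-∃′⁻ (k , ts) {ρ} (e , h) = e zero , e ∘ suc , rename⁻ bindFirst ts (++-bindFirst ρ e) h

  ⟪_⟫ : Formula 2 → BRel n
  ⟪ φ ⟫ a b = Sat φ (a V.∷ b V.∷ V.[])

  Definable : BRel n → Set
  Definable S = Σ (Formula 2) λ φ → S ⇔ ⟪ φ ⟫

  Definable⇒PPDefines : ∀ {S} → Definable S → PPDefines R S
  Definable⇒PPDefines ((k , ts) , S⇒φ , φ⇒S) = pp k ts , λ a b →
    (λ s → let e , h = S⇒φ s in e , Holds-resp ts (env≗ a b e) h) ,
    (λ (e , h) → φ⇒S (e , Holds-resp ts (sym ∘ env≗ a b e) h))
    where
    env≗ : ∀ a b e → (a V.∷ b V.∷ V.[]) ++ e ≗ env R a b e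
    env≗ a b e zero = refl
    env≗ a b e (suc zero) = refl
    env≗ a b e (suc (suc i)) = refl

  Definable-resp : ∀ {S T} → S ⇔ T → Definable S → Definable T
  Definable-resp (S⇒T , T⇒S) (φ , S⇒φ , φ⇒S) = φ , S⇒φ ∘ T⇒S , S⇒T ∘ φ⇒S

  R-definable : Definable R
  R-definable = (0 , rel zero (suc zero) ∷ []) , (λ r → (λ ()) , r ∷ []) , λ { (_ , r ∷ []) → r }

  ≡-definable : ∀ c → Definable (λ a _ → a ≡ c)
  ≡-definable c = (0 , const zero c ∷ []) , (λ p → (λ ()) , p ∷ []) , λ { (_ , p ∷ []) → p }

  ⊤-definable : Definable (λ _ _ → ⊤)
  ⊤-definable = (0 , []) , (λ _ → (λ ()) , []) , λ _ → tt

  conv-definable : ∀ {S} → Definable S → Definable (conv S)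
  conv-definable (φ , S⇒φ , φ⇒S) = φ [ swap ] ,
    (λ s → Sat-[]⁺ φ swap swapped (S⇒φ s)) , (λ s → φ⇒S (Sat-[]⁻ φ swap swapped s))
    where
    swap : Fin 2 → Fin 2
    swap = suc zero V.∷ zero V.∷ V.[]
    swapped : ∀ {a b} → (a V.∷ b V.∷ V.[]) ∘ swap ≗ b V.∷ a V.∷ V.[]
    swapped zero = refl
    swapped (suc zero) = refl

  ∩-definable : ∀ {S T} → Definable S → Definable T → Definable (S ∩ T)
  ∩-definable (φ , S⇒φ , φ⇒S) (ψ , T⇒ψ , ψ⇒T) = φ ∧ ψ ,
    (λ (s , t) → Sat-∧⁺ φ ψ (S⇒φ s) (T⇒ψ t)) ,
    (λ st → let s , t = Sat-∧⁻ φ ψ st in φ⇒S s , ψ⇒T t)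

  ⊕-definable : ∀ {S T} → Definable S → Definable T → Definable (S ⊕ T)
  ⊕-definable (φ , S⇒φ , φ⇒S) (ψ , T⇒ψ , ψ⇒T) = ∃′ ((φ [ x₁x₀ ]) ∧ (ψ [ x₀x₂ ])) ,
    (λ (z , s , t) → Sat-∃′⁺ _ z (Sat-∧⁺ (φ [ x₁x₀ ]) (ψ [ x₀x₂ ])
                                   (Sat-[]⁺ φ x₁x₀ first (S⇒φ s)) (Sat-[]⁺ ψ x₀x₂ second (T⇒ψ t)))) ,
    (λ st → let z , st′ = Sat-∃′⁻ _ st
                s , t = Sat-∧⁻ (φ [ x₁x₀ ]) (ψ [ x₀x₂ ]) st′
            in z , φ⇒S (Sat-[]⁻ φ x₁x₀ first s) , ψ⇒T (Sat-[]⁻ ψ x₀x₂ second t))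
    where
    x₁x₀ x₀x₂ : Fin 2 → Fin 3
    x₁x₀ = suc zero V.∷ zero V.∷ V.[]
    x₀x₂ = zero V.∷ suc (suc zero) V.∷ V.[]
    first : ∀ {z a b} → (z V.∷ a V.∷ b V.∷ V.[]) ∘ x₁x₀ ≗ a V.∷ z V.∷ V.[]
    first zero = refl
    first (suc zero) = refl
    second : ∀ {z a b} → (z V.∷ a V.∷ b V.∷ V.[]) ∘ x₀x₂ ≗ z V.∷ b V.∷ V.[]
    second zero = refl
    second (suc zero) = refl

  ^⁺-definable : ∀ {S} → Definable S → ∀ j → Definable (S ^⁺ j)
  ^⁺-definable S-def zero = S-def
  ^⁺-definable S-def (suc j) = ⊕-definable (^⁺-definable S-def j) S-def

  ⊖-definable : ∀ {S T} → Definable S → Definable T → Definable (S ⊖ T)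
  ⊖-definable S-def T-def = ⊕-definable S-def (conv-definable T-def)

module Conclusions {n : ℕ} (R : BRel n) where

  open PrimitivePositive R

  Conclusion : Set₁
  Conclusion = ∃ λ (S : BRel n) → PPDefines R S × Subdirect S × Proper S × Central S
    × (Symmetric S ⊎ Transitive S)

  conclusion : ∀ {S} → Definable S → Decidable S → ¬ Full S → Central S →
               Symmetric S ⊎ Transitive S → Conclusion
  conclusion {S} S-def S? ¬full central symOrTrans =
    S , Definable⇒PPDefines S-def , Central⇒Subdirect central , ¬Full⇒Proper S? ¬full ,
    central , symOrTrans

  conclusion-symmetric-centred : ∀ {S} → Definable S → Decidable S → ¬ Full S →
                         Symmetric S → ∀ {r} → RightCentre S r → Conclusion
  conclusion-symmetric-centred S-def S? ¬full S-sym {r} r-centre =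
    conclusion S-def S? ¬full ((r , λ b → S-sym b r (r-centre b)) , (r , r-centre)) (inj₁ S-sym)

  conclusion-bicentral : ∀ {S} → Definable S → Decidable S → ¬ Full S →
                         ∀ {e} → LeftCentre S e → RightCentre S e → Conclusion
  conclusion-bicentral S-def S? ¬full l-centre r-centre =
    conclusion-symmetric-centred (∩-definable S-def (conv-definable S-def)) (λ a b → S? a b ×-dec S? b a)
      (λ full → ¬full λ a b → proj₁ (full a b)) (λ a b (s , s′) → s′ , s)
      (λ a → r-centre a , l-centre a)

  UpperBound : BRel n → List (Fin n) → Fin n → Set
  UpperBound T X z = All (λ a → T a z) X

  LowerBound : BRel n → List (Fin n) → Fin n → Set
  LowerBound T Y z = All (T z) Y

  All-definable : (P : Fin n → Fin n → Set) → (∀ a → Definable (λ z _ → P a z)) →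
                  ∀ X → Definable (λ z _ → All (λ a → P a z) X)
  All-definable P P-def [] = Definable-resp ((λ _ → []) , (λ _ → tt)) ⊤-definable
  All-definable P P-def (a ∷ X) = Definable-resp ((λ (p , ps) → p ∷ ps) , (λ { (p ∷ ps) → p , ps }))
    (∩-definable (P-def a) (All-definable P P-def X))

  UpperBound-definable : ∀ {T} → Definable T → ∀ X → Definable (λ z _ → UpperBound T X z)
  UpperBound-definable T-def = All-definable _ λ a →
    Definable-resp ((λ { (_ , t , refl) → t }) , (λ t → a , t , refl))
      (⊕-definable (conv-definable T-def) (≡-definable a))

  LowerBound-definable : ∀ {T} → Definable T → ∀ Y → Definable (λ z _ → LowerBound T Y z)
  LowerBound-definable T-def = All-definable _ λ b →
    Definable-resp ((λ { (_ , t , refl) → t }) , (λ t → b , t , refl))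
      (⊕-definable T-def (≡-definable b))

  module _ {T : BRel n} (T-def : Definable T) (T? : Decidable T) where

    private
      D : List (Fin n) → BRel n
      D X = T ⊕ ((λ z _ → UpperBound T X z) ∩ conv T)

      D-definable : ∀ X → Definable (D X)
      D-definable X = ⊕-definable T-def (∩-definable (UpperBound-definable T-def X) (conv-definable T-def))

      D? : ∀ X → Decidable (D X)
      D? X = ⊕-dec T? λ z y → All.all? (λ a → T? a z) X ×-dec T? y z

      D-sym : ∀ {X} → Symmetric (D X)
      D-sym x y (z , t , above , t′) = z , t′ , above , t

    rightCentreOrConclusion : Fin n → Full (T ⊖ T) → Conclusion ⊎ ∃ (RightCentre T)
    rightCentreOrConclusion a₀ T⊖T-full with Full? (D? (allFin n))
    ... | yes D-full = let z , _ , above , _ = D-full a₀ a₀ in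
      inj₂ (z , λ a → All.lookup above (∈-allFin a))
    ... | no ¬D-full =
      let a , X , D-full , ¬D-full′ = firstFailingCons (Full? ∘ D?) D[]-full (allFin n) ¬D-full
      in inj₁ (conclusion-symmetric-centred (D-definable (a ∷ X)) (D? (a ∷ X)) ¬D-full′ D-sym
                 λ x → let z , t , above , t′ = D-full a x in z , t′ , t ∷ above , t)
      where
      D[]-full : Full (D [])
      D[]-full x y = let z , t , t′ = T⊖T-full x y in z , t , [] , t′

    conclusion-symmetric : Fin n → ¬ Full T → Symmetric T → Full (T ⊖ T) → Conclusion
    conclusion-symmetric a₀ ¬full T-sym T⊖T-full =
      [ id , (λ (r , r-centre) → conclusion-symmetric-centred T-def T? ¬full T-sym r-centre) ]′
        (rightCentreOrConclusion a₀ T⊖T-full)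

  module _ {T : BRel n} (T-def : Definable T) (T? : Decidable T) (¬full : ¬ Full T)
           {l} (l-centre : LeftCentre T l) {r} (r-centre : RightCentre T r) where

    private
      Xs Ys : List (Fin n)
      Xs = allFin n ∷ʳ r
      Ys = allFin n ∷ʳ l

      Between : List (Fin n) → List (Fin n) → Fin n → Set
      Between X Y z = UpperBound T X z × LowerBound T Y z

      H : List (Fin n) → List (Fin n) → BRel n
      H X Y = T ⊕ ((λ z _ → Between X Y z) ∩ T)

      H-definable : ∀ X Y → Definable (H X Y)
      H-definable X Y = ⊕-definable T-def
        (∩-definable (∩-definable (UpperBound-definable T-def X) (LowerBound-definable T-def Y)) T-def)

      H? : ∀ X Y → Decidable (H X Y)
      H? X Y = ⊕-dec T? λ z y → (All.all? (λ a → T? a z) X ×-dec All.all? (T? z) Y) ×-dec T? z y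

      reachedFromBetween : ∀ X Y → OnTail (λ X′ → Full (H X′ Y)) X →
                           ∀ y → ∃ λ z → Between X Y z × T z y
      reachedFromBetween [] Y _ y = l , ([] , All.universal l-centre Y) , l-centre y
      reachedFromBetween (a ∷ X) Y H-full y = let z , t , (above , below) , t′ = H-full a y in
        z , (t ∷ above , below) , t′

      reachesBetween : ∀ X Y → OnTail (Full ∘ H X) Y → ∀ x → ∃ λ z → T x z × Between X Y z
      reachesBetween X [] _ x = r , r-centre x , All.universal r-centre X , []
      reachesBetween X (b ∷ Y) H-full x = let z , t , (above , below) , t′ = H-full x b in
        z , t , above , t′ ∷ below

    -- A minimal failing pair of suffixes of Xs and Ys keeps r in X or l in Y, and that point lies
    -- in both centres of H X Y.
    conclusion-central-⊕-full : Full (T ⊕ T) → Conclusion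
    conclusion-central-⊕-full T⊕T-full with Full? (H? Xs Ys)
    ... | yes H-full = let z , _ , (above , below) , _ = H-full r r in
      conclusion-bicentral T-def T? ¬full {z}
        (λ b → All.lookup below (∈-++⁺ˡ (∈-allFin b)))
        (λ a → All.lookup above (∈-++⁺ˡ (∈-allFin a)))
    ... | no ¬H-full = corner (minimalFailure (λ X Y → Full? (H? X Y)) Xs Ys ¬H-full)
      where
      corner : MinimalFailure (λ X Y → Full? (H? X Y)) Xs Ys → Conclusion
      corner (minimal {[]} {[]} _ _ ¬H-full′ _ _) =
        contradiction (λ x y → let z , t , t′ = T⊕T-full x y in z , t , ([] , []) , t′) ¬H-full′
      corner (minimal {X@(_ ∷ _)} {Y} X-suffix _ ¬H-full′ left right) =
        let r∈X = ∈-suffix-∷ʳ (allFin n) X-suffix in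
        conclusion-bicentral (H-definable X Y) (H? X Y) ¬H-full′ {r}
          (λ y → let z , between , t′ = reachedFromBetween X Y left y in
                 z , All.lookup (proj₁ between) r∈X , between , t′)
          (λ x → let z , t , between = reachesBetween X Y right x in z , t , between , r-centre z)
      corner (minimal {[]} {Y@(_ ∷ _)} _ Y-suffix ¬H-full′ left right) =
        let l∈Y = ∈-suffix-∷ʳ (allFin n) Y-suffix in
        conclusion-bicentral (H-definable [] Y) (H? [] Y) ¬H-full′ {l}
          (λ y → let z , between , t′ = reachedFromBetween [] Y left y in z , l-centre z , between , t′)
          (λ x → let z , t , between = reachesBetween [] Y right x in
                 z , t , between , All.lookup (proj₂ between) l∈Y)

  conclusion-central : ∀ {S} → Definable S → Decidable S → ¬ Full S →
                       ∀ {l} → LeftCentre S l → ∀ {r} → RightCentre S r → Conclusion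
  conclusion-central {S} S-def S? ¬full l-centre r-centre
    with i , q , periodic ← eventuallyPeriodic (S ^⁺_) (^⁺-dec S?)
    with e , idempotent ← ^⁺-idempotent S {i} {q} periodic
    with Full? (^⁺-dec S? e)
  ... | no ¬full-e =
    conclusion (^⁺-definable S-def e) (^⁺-dec S? e) ¬full-e
      ((_ , LeftCentre-^⁺ l-centre e) , (_ , RightCentre-^⁺ r-centre e))
      (inj₂ λ a b c s s′ → proj₁ idempotent (b , s , s′))
  ... | yes full-e =
    let j , ¬full-j , full-j+1 = lastFailure (Full? ∘ ^⁺-dec S?) ¬full e full-e
        full-2j+1 = subst (Full ∘ (S ^⁺_)) (+-suc j j) (Full-^⁺-+ l-centre full-j+1 j)
    in conclusion-central-⊕-full (^⁺-definable S-def j) (^⁺-dec S? j) ¬full-j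
         (LeftCentre-^⁺ l-centre j) (RightCentre-^⁺ r-centre j)
         (λ a b → proj₂ (^⁺-+ S j j) (full-2j+1 a b))

  module _ (R? : Decidable R) (subdirect : Subdirect R) (proper : Proper R) where

    private
      a₀ = proj₁ proper

      ¬R-full : ¬ Full R
      ¬R-full full = let a , b , ¬Rab = proper in ¬Rab (full a b)

    conclusion-linked : Linked R → ¬ Full (R ⊖ R) → Conclusion
    conclusion-linked (m , linked) ¬full =
      let j , ¬full-j , full-j+1 = lastFailure (Full? ∘ ^⁺-dec (⊖-dec R? R?)) ¬full m full-m
          L-sym = Symmetric-^⁺ ⊖-self-sym j
      in conclusion-symmetric (^⁺-definable (⊖-definable R-definable R-definable) j)
           (^⁺-dec (⊖-dec R? R?) j) a₀ ¬full-j L-sym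
           λ a b → let c , l , e = full-j+1 a b in
                   c , l , L-sym c b (⊆-^⁺ (⊖-self-refl (proj₁ subdirect)) j e)
      where
      full-m : Full ((R ⊖ R) ^⁺ m)
      full-m a b = subst (λ L → L a b) (linkIter≡^⁺ R m)
        (proj₂ (linked a b) (proj₁ subdirect a , proj₁ subdirect b))

    conclusion-⊖-full : Full (R ⊖ R) → Conclusion
    conclusion-⊖-full R⊖R-full
      with rightCentreOrConclusion R-definable R? a₀ R⊖R-full
    ... | inj₁ done = done
    ... | inj₂ (r , r-centre) with Full? (⊖-dec (conv-dec R?) (conv-dec R?))
    ...   | yes R⁻¹⊖R⁻¹-full =
      [ id , (λ (l , l-centre) → conclusion-central R-definable R? ¬R-full l-centre r-centre) ]′
        (rightCentreOrConclusion (conv-definable R-definable) (conv-dec R?) a₀ R⁻¹⊖R⁻¹-full)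
    ...   | no ¬R⁻¹⊖R⁻¹-full =
      conclusion-symmetric (⊖-definable (conv-definable R-definable) (conv-definable R-definable))
        (⊖-dec (conv-dec R?) (conv-dec R?)) a₀ ¬R⁻¹⊖R⁻¹-full ⊖-self-sym
        λ x y → let u , Rux = proj₂ subdirect x
                    v , Rvy = proj₂ subdirect y
                    w , Ruw , Rvw = R⊖R-full u v
                in w , (u , Rux , Ruw) , (v , Rvy , Rvw)

mainTheorem2 : (n : ℕ) (R : BRel n) → Decidable R →
    Subdirect R → Linked R → Proper R →
    ∃ λ (S : BRel n) → PPDefines R S × Subdirect S × Proper S × Central S
    × (Symmetric S ⊎ Transitive S)
mainTheorem2 n R R? subdirect linked proper with Full? (⊖-dec R? R?)
... | yes R⊖R-full = Conclusions.conclusion-⊖-full R R? subdirect proper R⊖R-full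
... | no ¬R⊖R-full = Conclusions.conclusion-linked R R? subdirect proper linked ¬R⊖R-full
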